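{- If $T$ is a regular tournament with $\gamma(T)\geq 4$, then $T$ is out-quadrangular.
   Context: A tournament is a loopless digraph in which for each pair of distinct vertices exactly one of $(u,v)$, $(v,u)$ is an arc; it is regular if all vertices have equal out-degree. $O(v)$ is the set of vertices $v$ beats. A digraph is out-quadrangular if $|O(u)\cap O(v)|\neq 1$ for all distinct vertices $u,v$. A dominating set of $T$ is a set $S$ of vertices such that every vertex is in $S$ or dominated by some vertex of $S$; $\gamma(T)$ is the minimum size of a dominating set. -}

module Defs where

open import Data.Nat using (ℕ; _≥_)
open import Data.Bool using (Bool; true; false; _∧_; T)
open import Data.Fin using (Fin)
open import Data.Fin.Subset using (Subset; _∈_; ∣_∣)
open import Data.Vec using (tabulate; count)
open import Data.Vec.Functional using () 
open import Data.Product using (Σ; _×_; ∃-syntax)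
open import Data.Sum using (_⊎_)
open import Relation.Nullary using (¬_)
open import Relation.Binary.PropositionalEquality using (_≡_; _≢_)
open import Data.Bool.Properties using (T?)

-- A digraph on the vertex set Fin n, given by its adjacency relation:
-- arc u v ≡ true  means (u , v) is an arc, i.e. u beats v.
Digraph : ℕ → Set
Digraph n = Fin n → Fin n → Bool

record IsTournament {n : ℕ} (D : Digraph n) : Set where
  field
    loopless : ∀ u → D u u ≡ false
    oneWay   : ∀ u v → u ≢ v → (D u v ≡ true × D v u ≡ false) ⊎ (D u v ≡ false × D v u ≡ true)

outDeg : {n : ℕ} → Digraph n → Fin n → ℕ
outDeg {n} D u = count (λ v → T? v) (tabulate (D u))

IsRegular : {n : ℕ} → Digraph n → Set
IsRegular D = ∀ u v → outDeg D u ≡ outDeg D v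

commonOut : {n : ℕ} → Digraph n → Fin n → Fin n → ℕ
commonOut D u v = count (λ b → T? b) (tabulate (λ w → D u w ∧ D v w))

IsOutQuadrangular : {n : ℕ} → Digraph n → Set
IsOutQuadrangular D = ∀ u v → u ≢ v → commonOut D u v ≢ 1

IsDominating : {n : ℕ} → Digraph n → Subset n → Set
IsDominating {n} D S = ∀ (v : Fin n) → v ∈ S ⊎ (∃[ s ] (s ∈ S × D s v ≡ true))

DomNumberAtLeast : {n : ℕ} → Digraph n → ℕ → Set
DomNumberAtLeast D k = ∀ S → IsDominating D S → ∣ S ∣ ≥ k

{-# OPTIONS --safe #-}
-- In a regular tournament of order n every vertex has out-degree d with
-- n = 2d + 1, by double counting the arcs. If v does not beat u and
-- |O(u) ∩ O(v)| = 1, then |O(u) ∪ O(v)| = 2d - 1, so exactly two vertices,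
-- u among them, are beaten by neither u nor v; together with v they form a
-- dominating set of size 3.
module Submission where

open import Defs
open import Data.Nat using (ℕ; zero; suc; _+_; _*_; _∸_; _≤_; s≤s)
open import Data.Nat.Properties
  using (+-suc; +-comm; +-cancelˡ-≡; +-cancelʳ-≡; *-cancelˡ-≡; m+n∸m≡n;
         *-identityʳ; m≤m+n; ≤-trans; ≤-reflexive; <⇒≱; +-0-commutativeMonoid)
open import Data.Bool using (Bool; true; false; _∧_)
open import Data.Bool.Properties using (T?; ∧-comm)
open import Data.Fin using (Fin; zero; suc)
open import Data.Fin.Properties using (_≟_; nonZeroIndex)
open import Data.Fin.Subset using (Subset; _∈_; _∉_; ∣_∣; ⁅_⁆; _∪_; _∩_; ∁)
open import Data.Fin.Subset.Properties
  using (_∈?_; x∈⁅x⁆; ∣⁅x⁆∣≡1; x∈p∪q⁺; x∈p∪q⁻; x∉p⇒x∈∁p; ∣∁p∣≡n∸∣p∣)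
open import Data.Vec using ([]; _∷_; tabulate; zipWith; count)
open import Data.Vec.Properties using (lookup∘tabulate; []=⇒lookup; tabulate-cong)
open import Data.Product using (_×_; _,_; ∃-syntax)
open import Data.Sum using (inj₁; inj₂; [_,_])
open import Data.Empty using (⊥)
open import Function using (_∘_; flip)
open import Relation.Nullary using (does; yes; no)
open import Relation.Binary.PropositionalEquality
  using (_≡_; refl; sym; trans; cong; cong₂; module ≡-Reasoning)
open import Algebra.Properties.CommutativeMonoid.Sum +-0-commutativeMonoid
  using (sum-syntax; ∑-comm; ∑-distrib-+; sum-cong-≗; sum-replicate-zero)

𝟙 : Bool → ℕ
𝟙 true  = 1
𝟙 false = 0

∑-const : ∀ n c → ∑[ i < n ] c ≡ n * c
∑-const zero    c = refl
∑-const (suc n) c = cong (c +_) (∑-const n c)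

∑-𝟙-≟≡1 : ∀ {n} (u : Fin n) → ∑[ w < n ] 𝟙 (does (u ≟ w)) ≡ 1
∑-𝟙-≟≡1 {suc n} zero    = cong suc (sum-replicate-zero n)
∑-𝟙-≟≡1 {suc n} (suc u) = ∑-𝟙-≟≡1 u

count-T?-tabulate : ∀ {n} (f : Fin n → Bool) → count T? (tabulate f) ≡ ∑[ i < n ] 𝟙 (f i)
count-T?-tabulate {zero}  f = refl
count-T?-tabulate {suc n} f with f zero
... | true  = cong suc (count-T?-tabulate (f ∘ suc))
... | false = count-T?-tabulate (f ∘ suc)

count-T?≡∣_∣ : ∀ {n} (p : Subset n) → count T? p ≡ ∣ p ∣
count-T?≡∣ []        ∣ = refl
count-T?≡∣ true  ∷ p ∣ = cong suc count-T?≡∣ p ∣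
count-T?≡∣ false ∷ p ∣ = count-T?≡∣ p ∣

tabulate-zipWith : ∀ {n} {A B C : Set} (_∙_ : A → B → C) (f : Fin n → A) (g : Fin n → B) →
                   tabulate (λ i → f i ∙ g i) ≡ zipWith _∙_ (tabulate f) (tabulate g)
tabulate-zipWith {zero}  _∙_ f g = refl
tabulate-zipWith {suc n} _∙_ f g = cong (f zero ∙ g zero ∷_) (tabulate-zipWith _∙_ (f ∘ suc) (g ∘ suc))

∈-tabulate⁻ : ∀ {n} {f : Fin n → Bool} {x} → x ∈ tabulate f → f x ≡ true
∈-tabulate⁻ {f = f} {x} x∈ = trans (sym (lookup∘tabulate f x)) ([]=⇒lookup x∈)

∉-tabulate : ∀ {n} {f : Fin n → Bool} {x} → f x ≡ false → x ∉ tabulate f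
∉-tabulate fx≡false x∈ with () ← trans (sym (∈-tabulate⁻ x∈)) fx≡false

∣p∪q∣+∣p∩q∣≡∣p∣+∣q∣ : ∀ {n} (p q : Subset n) → ∣ p ∪ q ∣ + ∣ p ∩ q ∣ ≡ ∣ p ∣ + ∣ q ∣
∣p∪q∣+∣p∩q∣≡∣p∣+∣q∣ []          []          = refl
∣p∪q∣+∣p∩q∣≡∣p∣+∣q∣ (true  ∷ p) (true  ∷ q) = cong suc (begin
  ∣ p ∪ q ∣ + suc ∣ p ∩ q ∣  ≡⟨ +-suc _ _ ⟩
  suc (∣ p ∪ q ∣ + ∣ p ∩ q ∣) ≡⟨ cong suc (∣p∪q∣+∣p∩q∣≡∣p∣+∣q∣ p q) ⟩
  suc (∣ p ∣ + ∣ q ∣)         ≡⟨ +-suc _ _ ⟨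
  ∣ p ∣ + suc ∣ q ∣           ∎)
  where open ≡-Reasoning
∣p∪q∣+∣p∩q∣≡∣p∣+∣q∣ (true  ∷ p) (false ∷ q) = cong suc (∣p∪q∣+∣p∩q∣≡∣p∣+∣q∣ p q)
∣p∪q∣+∣p∩q∣≡∣p∣+∣q∣ (false ∷ p) (true  ∷ q) =
  trans (cong suc (∣p∪q∣+∣p∩q∣≡∣p∣+∣q∣ p q)) (sym (+-suc _ _))
∣p∪q∣+∣p∩q∣≡∣p∣+∣q∣ (false ∷ p) (false ∷ q) = ∣p∪q∣+∣p∩q∣≡∣p∣+∣q∣ p q

∣p∪q∣≤∣p∣+∣q∣ : ∀ {n} (p q : Subset n) → ∣ p ∪ q ∣ ≤ ∣ p ∣ + ∣ q ∣
∣p∪q∣≤∣p∣+∣q∣ p q = ≤-trans (m≤m+n _ _) (≤-reflexive (∣p∪q∣+∣p∩q∣≡∣p∣+∣q∣ p q))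

module _ {n : ℕ} (D : Digraph n) where

  out : Fin n → Subset n
  out u = tabulate (D u)

  inDeg : Fin n → ℕ
  inDeg = outDeg (flip D)

  outDeg≡∣out∣ : ∀ u → outDeg D u ≡ ∣ out u ∣
  outDeg≡∣out∣ u = count-T?≡∣ out u ∣

  commonOut≡∣out∩out∣ : ∀ u v → commonOut D u v ≡ ∣ out u ∩ out v ∣
  commonOut≡∣out∩out∣ u v =
    trans count-T?≡∣ tabulate (λ w → D u w ∧ D v w) ∣ (cong ∣_∣ (tabulate-zipWith _∧_ (D u) (D v)))

  commonOut-comm : ∀ u v → commonOut D u v ≡ commonOut D v u
  commonOut-comm u v = cong (count T?) (tabulate-cong (λ w → ∧-comm (D u w) (D v w)))

  ∑outDeg≡∑inDeg : ∑[ u < n ] outDeg D u ≡ ∑[ u < n ] inDeg u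
  ∑outDeg≡∑inDeg = begin
    ∑[ u < n ] outDeg D u               ≡⟨ sum-cong-≗ (count-T?-tabulate ∘ D) ⟩
    ∑[ u < n ] ∑[ w < n ] 𝟙 (D u w)     ≡⟨ ∑-comm (λ u w → 𝟙 (D u w)) ⟩
    ∑[ w < n ] ∑[ u < n ] 𝟙 (D u w)     ≡⟨ sum-cong-≗ (count-T?-tabulate ∘ flip D) ⟨
    ∑[ w < n ] inDeg w                  ∎
    where open ≡-Reasoning

  ∉-out∪out : ∀ {u v x} → D u x ≡ false → D v x ≡ false → x ∉ out u ∪ out v
  ∉-out∪out {u} {v} Dux≡false Dvx≡false =
    [ ∉-tabulate Dux≡false , ∉-tabulate Dvx≡false ] ∘ x∈p∪q⁻ (out u) (out v)

  uncovered : Fin n → Fin n → Subset n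
  uncovered u v = ∁ (out u ∪ out v)

  ⁅v⁆∪uncovered-dominating : ∀ {u v} → D u u ≡ false → D v u ≡ false →
                             IsDominating D (⁅ v ⁆ ∪ uncovered u v)
  ⁅v⁆∪uncovered-dominating {u} {v} Duu≡false Dvu≡false w with w ∈? out u ∪ out v
  ... | no  w∉ = inj₁ (x∈p∪q⁺ (inj₂ (x∉p⇒x∈∁p w∉)))
  ... | yes w∈ with x∈p∪q⁻ (out u) (out v) w∈
  ...   | inj₁ w∈out-u =
    inj₂ (u , x∈p∪q⁺ (inj₂ (x∉p⇒x∈∁p (∉-out∪out Duu≡false Dvu≡false))) , ∈-tabulate⁻ w∈out-u)
  ...   | inj₂ w∈out-v =
    inj₂ (v , x∈p∪q⁺ (inj₁ (x∈⁅x⁆ v)) , ∈-tabulate⁻ w∈out-v)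

module _ {n : ℕ} {D : Digraph n} (tournament : IsTournament D) where
  open IsTournament tournament

  𝟙-trichotomy : ∀ u w → 𝟙 (D u w) + 𝟙 (D w u) + 𝟙 (does (u ≟ w)) ≡ 1
  𝟙-trichotomy u w with u ≟ w
  ... | yes refl rewrite loopless u = refl
  ... | no u≢w with oneWay u w u≢w
  ...   | inj₁ (Duw , Dwu) rewrite Duw | Dwu = refl
  ...   | inj₂ (Duw , Dwu) rewrite Duw | Dwu = refl

  outDeg+inDeg+1≡n : ∀ u → outDeg D u + inDeg D u + 1 ≡ n
  outDeg+inDeg+1≡n u = begin
    outDeg D u + inDeg D u + 1
      ≡⟨ cong₂ _+_ (cong₂ _+_ (count-T?-tabulate (D u)) (count-T?-tabulate (flip D u))) (sym (∑-𝟙-≟≡1 u)) ⟩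
    ∑[ w < n ] 𝟙 (D u w) + ∑[ w < n ] 𝟙 (D w u) + ∑[ w < n ] 𝟙 (does (u ≟ w))
      ≡⟨ cong (_+ _) (∑-distrib-+ (λ w → 𝟙 (D u w)) (λ w → 𝟙 (D w u))) ⟨
    ∑[ w < n ] (𝟙 (D u w) + 𝟙 (D w u)) + ∑[ w < n ] 𝟙 (does (u ≟ w))
      ≡⟨ ∑-distrib-+ (λ w → 𝟙 (D u w) + 𝟙 (D w u)) (λ w → 𝟙 (does (u ≟ w))) ⟨
    ∑[ w < n ] (𝟙 (D u w) + 𝟙 (D w u) + 𝟙 (does (u ≟ w)))
      ≡⟨ sum-cong-≗ (𝟙-trichotomy u) ⟩
    ∑[ w < n ] 1
      ≡⟨ ∑-const n 1 ⟩
    n * 1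
      ≡⟨ *-identityʳ n ⟩
    n ∎
    where open ≡-Reasoning

  module _ (regular : IsRegular D) where

    regular⇒n≡1+d+d : ∀ u → n ≡ suc (outDeg D u + outDeg D u)
    regular⇒n≡1+d+d u = begin
      n               ≡⟨ outDeg+inDeg+1≡n u ⟨
      d + e + 1       ≡⟨ cong (λ x → d + x + 1) d≡e ⟨
      d + d + 1       ≡⟨ +-comm (d + d) 1 ⟩
      suc (d + d)     ∎
      where
      open ≡-Reasoning
      d e : ℕ
      d = outDeg D u
      e = inDeg D u

      inDeg≡e : ∀ w → inDeg D w ≡ e
      inDeg≡e w = +-cancelˡ-≡ d _ _ (+-cancelʳ-≡ 1 _ _ (begin
        d + inDeg D w + 1           ≡⟨ cong (λ x → x + inDeg D w + 1) (regular w u) ⟨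
        outDeg D w + inDeg D w + 1  ≡⟨ outDeg+inDeg+1≡n w ⟩
        n                           ≡⟨ outDeg+inDeg+1≡n u ⟨
        d + e + 1                   ∎))

      d≡e : d ≡ e
      d≡e = *-cancelˡ-≡ d e n {{nonZeroIndex u}} (begin
        n * d                  ≡⟨ ∑-const n d ⟨
        ∑[ w < n ] d           ≡⟨ sum-cong-≗ (λ w → regular w u) ⟨
        ∑[ w < n ] outDeg D w  ≡⟨ ∑outDeg≡∑inDeg D ⟩
        ∑[ w < n ] inDeg D w   ≡⟨ sum-cong-≗ inDeg≡e ⟩
        ∑[ w < n ] e           ≡⟨ ∑-const n e ⟩
        n * e                  ∎)

    commonOut≡1⇒γ≤3 : ∀ {u v} → D v u ≡ false → commonOut D u v ≡ 1 →
                      ∃[ S ] (IsDominating D S × ∣ S ∣ ≤ 3)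
    commonOut≡1⇒γ≤3 {u} {v} Dvu≡false common≡1 =
      ⁅ v ⁆ ∪ uncovered D u v ,
      ⁅v⁆∪uncovered-dominating D (loopless u) Dvu≡false ,
      ≤-trans (∣p∪q∣≤∣p∣+∣q∣ ⁅ v ⁆ (uncovered D u v))
              (≤-reflexive (cong₂ _+_ (∣⁅x⁆∣≡1 v) ∣uncovered∣≡2))
      where
      open ≡-Reasoning
      d : ℕ
      d = outDeg D u
      X : Subset n
      X = out D u ∪ out D v

      ∣X∣+1≡d+d : ∣ X ∣ + 1 ≡ d + d
      ∣X∣+1≡d+d = begin
        ∣ X ∣ + 1
          ≡⟨ cong (∣ X ∣ +_) (trans (sym common≡1) (commonOut≡∣out∩out∣ D u v)) ⟩
        ∣ X ∣ + ∣ out D u ∩ out D v ∣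
          ≡⟨ ∣p∪q∣+∣p∩q∣≡∣p∣+∣q∣ (out D u) (out D v) ⟩
        ∣ out D u ∣ + ∣ out D v ∣
          ≡⟨ cong₂ _+_ (outDeg≡∣out∣ D u) (trans (sym (regular v u)) (outDeg≡∣out∣ D v)) ⟨
        d + d
          ∎

      ∣uncovered∣≡2 : ∣ uncovered D u v ∣ ≡ 2
      ∣uncovered∣≡2 = begin
        ∣ ∁ X ∣                  ≡⟨ ∣∁p∣≡n∸∣p∣ X ⟩
        n ∸ ∣ X ∣                ≡⟨ cong (_∸ ∣ X ∣) (regular⇒n≡1+d+d u) ⟩
        suc (d + d) ∸ ∣ X ∣      ≡⟨ cong (λ m → suc m ∸ ∣ X ∣) ∣X∣+1≡d+d ⟨
        suc (∣ X ∣ + 1) ∸ ∣ X ∣  ≡⟨ cong (_∸ ∣ X ∣) (+-suc ∣ X ∣ 1) ⟨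
        ∣ X ∣ + 2 ∸ ∣ X ∣        ≡⟨ m+n∸m≡n ∣ X ∣ 2 ⟩
        2                        ∎

theorem16 : (n : ℕ) (T : Digraph n) → IsTournament T → IsRegular T →
    DomNumberAtLeast T 4 → IsOutQuadrangular T
theorem16 n T tournament regular γ≥4 u v u≢v common≡1 =
  [ (λ (_ , Tvu≡false) → refute (commonOut≡1⇒γ≤3 tournament regular Tvu≡false common≡1))
  , (λ (Tuv≡false , _) → refute (commonOut≡1⇒γ≤3 tournament regular Tuv≡false
                                   (trans (commonOut-comm T v u) common≡1)))
  ] (IsTournament.oneWay tournament u v u≢v)
  where
  refute : ∃[ S ] (IsDominating T S × ∣ S ∣ ≤ 3) → ⊥
  refute (S , dominating , ∣S∣≤3) = <⇒≱ (s≤s ∣S∣≤3) (γ≥4 S dominating)
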